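{- (1) If $A\in\Omega^+$ (resp. $A\in\Omega^-$) and $A\approx B$, then $B\in\Omega^+$ (resp. $B\in\Omega^-$). (2) If $A\in\Omega^-$ and $A\triangleleft B\rightarrow D$, then $B\in\Omega^+$ and $D\in\Omega^-$.
   Context: Types of $AF2$: second-order formulas built from $\perp$ and atomic formulas $R(t_1,\dots,t_k)$ using $\rightarrow,\forall x,\forall X$, over first-order terms; a fixed set of equations is given and $u\approx v$ means $u=v$ follows from it. On types, $\approx$ is the least reflexive transitive relation with $C[u/x]\approx C[v/x]$ whenever $u\approx v$; $\triangleleft$ is the least reflexive transitive relation with $\forall xA\triangleleft A[u/x]$ for every first-order term $u$ and $\forall XA\triangleleft A[F/X]$ for every formula $F$. $\Omega^+$ ($\forall$-positive types) and $\Omega^-$ ($\forall$-negative types) are the least sets such that: atomic types are in both; if $T\in\Omega^+$ and $T'\in\Omega^-$ then $T'\rightarrow T\in\Omega^+$ and $T\rightarrow T'\in\Omega^-$; if $T\in\Omega^+$ then $\forall xT\in\Omega^+$ and $\forall XT\in\Omega^+$; if $T\in\Omega^-$ then $\forall xT\in\Omega^-$, and $\forall XT\in\Omega^-$ provided $X$ has no free occurrence in $T$. -}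

module Defs where

open import Data.Nat using (ℕ; zero; suc; _≡ᵇ_)
open import Data.Vec using (Vec; []; _∷_; tabulate)
open import Data.Vec.Relation.Binary.Pointwise.Inductive using (Pointwise)
open import Data.Fin using (toℕ)
open import Data.Bool using (if_then_else_)
open import Relation.Nullary using (¬_)

record Signature : Set₁ where
  field
    Fun   : Set
    arity : Fun → ℕ
open Signature public

data Term (S : Signature) : Set where
  var : ℕ → Term S
  fun : (f : Fun S) → Vec (Term S) (arity S f) → Term S

-- AF2 types.  First-order variables are de Bruijn indices (bound by ∀¹);
-- second-order variables are pairs (arity k, de Bruijn index n within the
-- arity-k namespace), bound by  ∀² k.
data Ty (S : Signature) : Set where
  bot   : Ty S
  atom  : (k : ℕ) → ℕ → Vec (Term S) k → Ty S
  _⇒_   : Ty S → Ty S → Ty S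
  ∀¹    : Ty S → Ty S
  ∀²    : ℕ → Ty S → Ty S

infixr 5 _⇒_

module _ {S : Signature} where

  subTm  : (ℕ → Term S) → Term S → Term S
  subTms : ∀ {n} → (ℕ → Term S) → Vec (Term S) n → Vec (Term S) n
  subTm σ (var i) = σ i
  subTm σ (fun f ts) = fun f (subTms σ ts)
  subTms σ [] = []
  subTms σ (t ∷ ts) = subTm σ t ∷ subTms σ ts

  lift : (ℕ → Term S) → ℕ → Term S
  lift σ zero = var zero
  lift σ (suc i) = subTm (λ j → var (suc j)) (σ i)

  liftN : ℕ → (ℕ → Term S) → ℕ → Term S
  liftN zero σ = σ
  liftN (suc k) σ = lift (liftN k σ)

  subTy : (ℕ → Term S) → Ty S → Ty S
  subTy σ bot = bot
  subTy σ (atom k n ts) = atom k n (subTms σ ts)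
  subTy σ (A ⇒ B) = subTy σ A ⇒ subTy σ B
  subTy σ (∀¹ A) = ∀¹ (subTy (lift σ) A)
  subTy σ (∀² k A) = ∀² k (subTy σ A)

  -- second-order renaming and substitution
  -- shiftR k k' n : shift index n of arity k' past a new binder of arity k
  shiftR : ℕ → ℕ → ℕ → ℕ
  shiftR k k' n = if k' ≡ᵇ k then suc n else n

  liftR : ℕ → (ℕ → ℕ → ℕ) → ℕ → ℕ → ℕ
  liftR k r k' zero = if k' ≡ᵇ k then zero else r k' zero
  liftR k r k' (suc m) = if k' ≡ᵇ k then suc (r k' m) else r k' (suc m)

  ren2 : (ℕ → ℕ → ℕ) → Ty S → Ty S
  ren2 r bot = bot
  ren2 r (atom k n ts) = atom k (r k n) ts
  ren2 r (A ⇒ B) = ren2 r A ⇒ ren2 r B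
  ren2 r (∀¹ A) = ∀¹ (ren2 r A)
  ren2 r (∀² k A) = ∀² k (ren2 (liftR k r) A)

  -- the atom X_n(x₀,…,x_{k-1}) : identity abstraction for a k-ary variable
  idAtom : (k : ℕ) → ℕ → Ty S
  idAtom k n = atom k n (tabulate (λ i → var (toℕ i)))

  params : ∀ {k} → Vec (Term S) k → ℕ → Term S
  params [] i = var i
  params (t ∷ ts) zero = t
  params (t ∷ ts) (suc i) = params ts i

  -- A second-order substitution assigns to a k-ary variable n a formula
  -- whose first-order indices 0..k-1 are the abstracted parameters.
  Sub2 : Set
  Sub2 = ℕ → ℕ → Ty S

  lift2¹ : Sub2 → Sub2
  lift2¹ τ k n = subTy (liftN k (λ j → var (suc j))) (τ k n)

  lift2² : ℕ → Sub2 → Sub2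
  lift2² k τ k' zero = if k' ≡ᵇ k then idAtom k' zero else ren2 (shiftR k) (τ k' zero)
  lift2² k τ k' (suc m) = if k' ≡ᵇ k then ren2 (shiftR k) (τ k' m) else ren2 (shiftR k) (τ k' (suc m))

  sub2 : Sub2 → Ty S → Ty S
  sub2 τ bot = bot
  sub2 τ (atom k n ts) = subTy (params ts) (τ k n)
  sub2 τ (A ⇒ B) = sub2 τ A ⇒ sub2 τ B
  sub2 τ (∀¹ A) = ∀¹ (sub2 (lift2¹ τ) A)
  sub2 τ (∀² k A) = ∀² k (sub2 (lift2² k τ) A)

  inst¹ : Term S → Ty S → Ty S
  inst¹ u = subTy σ
    where
    σ : ℕ → Term S
    σ zero = u
    σ (suc i) = var i

  inst² : ℕ → Ty S → Ty S → Ty S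
  inst² k F = sub2 τ
    where
    τ : Sub2
    τ k' zero = if k' ≡ᵇ k then F else idAtom k' zero
    τ k' (suc m) = if k' ≡ᵇ k then idAtom k' m else idAtom k' (suc m)

  _[_/_] : Ty S → Term S → ℕ → Ty S
  C [ u / x ] = subTy (λ i → if i ≡ᵇ x then u else var i) C

  data _⊢_≈ₜ_ (E : Term S → Term S → Set) : Term S → Term S → Set where
    ax    : ∀ {l r} → E l r → (σ : ℕ → Term S) → E ⊢ subTm σ l ≈ₜ subTm σ r
    refl  : ∀ {u} → E ⊢ u ≈ₜ u
    sym   : ∀ {u v} → E ⊢ u ≈ₜ v → E ⊢ v ≈ₜ u
    trans : ∀ {u v w} → E ⊢ u ≈ₜ v → E ⊢ v ≈ₜ w → E ⊢ u ≈ₜ w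
    cong  : ∀ f {us vs} → Pointwise (E ⊢_≈ₜ_) us vs → E ⊢ fun f us ≈ₜ fun f vs

  data _⊢_≈_ (E : Term S → Term S → Set) : Ty S → Ty S → Set where
    refl  : ∀ {A} → E ⊢ A ≈ A
    trans : ∀ {A B C} → E ⊢ A ≈ B → E ⊢ B ≈ C → E ⊢ A ≈ C
    step  : ∀ C x {u v} → E ⊢ u ≈ₜ v → E ⊢ (C [ u / x ]) ≈ (C [ v / x ])

  data _◁_ : Ty S → Ty S → Set where
    refl  : ∀ {A} → A ◁ A
    trans : ∀ {A B C} → A ◁ B → B ◁ C → A ◁ C
    inst¹◁ : ∀ A u → ∀¹ A ◁ inst¹ u A
    inst²◁ : ∀ k A F → ∀² k A ◁ inst² k F A

  data Occ2 (k : ℕ) : ℕ → Ty S → Set where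
    here : ∀ {n} {ts : Vec (Term S) k} → Occ2 k n (atom k n ts)
    ⇒ˡ   : ∀ {n A B} → Occ2 k n A → Occ2 k n (A ⇒ B)
    ⇒ʳ   : ∀ {n A B} → Occ2 k n B → Occ2 k n (A ⇒ B)
    all¹ : ∀ {n A} → Occ2 k n A → Occ2 k n (∀¹ A)
    all² : ∀ {k' n A} → Occ2 k (shiftR k' k n) A → Occ2 k n (∀² k' A)

  data Ω⁺ : Ty S → Set
  data Ω⁻ : Ty S → Set

  data Ω⁺ where
    bot⁺  : Ω⁺ bot
    atom⁺ : ∀ k n ts → Ω⁺ (atom k n ts)
    ⇒⁺    : ∀ {T T'} → Ω⁻ T' → Ω⁺ T → Ω⁺ (T' ⇒ T)
    ∀¹⁺   : ∀ {T} → Ω⁺ T → Ω⁺ (∀¹ T)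
    ∀²⁺   : ∀ {k T} → Ω⁺ T → Ω⁺ (∀² k T)

  data Ω⁻ where
    bot⁻  : Ω⁻ bot
    atom⁻ : ∀ k n ts → Ω⁻ (atom k n ts)
    ⇒⁻    : ∀ {T T'} → Ω⁺ T → Ω⁻ T' → Ω⁻ (T ⇒ T')
    ∀¹⁻   : ∀ {T} → Ω⁻ T → Ω⁻ (∀¹ T)
    ∀²⁻   : ∀ {k T} → Ω⁻ T → ¬ Occ2 k zero T → Ω⁻ (∀² k T)

module Submission where

-- Membership in Ω± depends only on the skeleton of a type: its connectives
-- and which second-order variables occur free, never on the first-order
-- terms inside atoms.  Accordingly:
--  * a first-order substitution preserves and reflects Ω± (it does not
--    change free second-order occurrences).  Since C[u/x] and C[v/x] are
--    both first-order instances of C, every ≈-step preserves Ω±, giving (1);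
--  * a second-order substitution that sends every variable occurring free
--    in A to an atom preserves Ω±.  The delicate point is the side condition
--    "X not free" of ∀X T ∈ Ω⁻, for which we describe the free variables of
--    sub2 τ A through those of A and of the τ k n, and check that the
--    renaming applied under a binder never produces the bound variable.
-- If ∀X A ∈ Ω⁻ then X is not free in A, so A[F/X] is such an atomic
-- instance.  Hence Ω⁻ is closed under ◁, and (2) follows by inverting
-- B ⇒ D ∈ Ω⁻.

open import Defs
open import Data.Product using (_×_; Σ-syntax; _,_)
open import Data.Nat using (ℕ; zero; suc; _≡ᵇ_; _≟_)
open import Data.Nat.Properties using (suc-injective)
open import Data.Bool using (true; false; if_then_else_)
open import Data.Bool.Properties using (if-cong)
open import Data.Empty using (⊥-elim)
open import Data.Vec using (Vec)
open import Relation.Nullary using (¬_; yes; no)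
open import Relation.Binary.PropositionalEquality
  using (_≡_; _≢_; refl; subst; module ≡-Reasoning)
  renaming (sym to ≡-sym; trans to ≡-trans; cong to ≡-cong)

module _ {S : Signature} where

  open ≡-Reasoning

  -- The index shift of Defs does not involve the signature; fix S once.
  shift : ℕ → ℕ → ℕ → ℕ
  shift = shiftR {S}

  ≡ᵇ-same : ∀ k → (k ≡ᵇ k) ≡ true
  ≡ᵇ-same zero    = refl
  ≡ᵇ-same (suc k) = ≡ᵇ-same k

  ≡ᵇ-other : ∀ {j k} → j ≢ k → (j ≡ᵇ k) ≡ false
  ≡ᵇ-other {zero}  {zero}  j≢k = ⊥-elim (j≢k refl)
  ≡ᵇ-other {zero}  {suc k} _   = refl
  ≡ᵇ-other {suc j} {zero}  _   = refl
  ≡ᵇ-other {suc j} {suc k} j≢k = ≡ᵇ-other (λ j≡k → j≢k (≡-cong suc j≡k))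

  shift-same : ∀ k m → shift k k m ≡ suc m
  shift-same k m = if-cong (≡ᵇ-same k)

  shift-other : ∀ {j k} → j ≢ k → ∀ m → shift k j m ≡ m
  shift-other j≢k m = if-cong (≡ᵇ-other j≢k)

  shift-≢-bound : ∀ k m → shift k k m ≢ zero
  shift-≢-bound k m eq with ≡-trans (≡-sym (shift-same k m)) eq
  ... | ()

  shift-injective : ∀ k j {p m} → shift k j p ≡ shift k j m → p ≡ m
  shift-injective k j {p} {m} eq with j ≟ k
  ... | yes refl = suc-injective (begin
          suc p        ≡⟨ ≡-sym (shift-same k p) ⟩
          shift k k p  ≡⟨ eq ⟩
          shift k k m  ≡⟨ shift-same k m ⟩
          suc m        ∎)
  ... | no j≢k = begin
          p            ≡⟨ ≡-sym (shift-other j≢k p) ⟩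
          shift k j p  ≡⟨ eq ⟩
          shift k j m  ≡⟨ shift-other j≢k m ⟩
          m            ∎

  data Scoped (k : ℕ) : ℕ → ℕ → Set where
    bound   : Scoped k k zero
    shifted : ∀ {j} m → Scoped k j (shift k j m)

  scoped : ∀ k j n → Scoped k j n
  scoped k j n with j ≟ k
  scoped k .k zero    | yes refl = bound
  scoped k .k (suc m) | yes refl = subst (Scoped k k) (shift-same k m) (shifted m)
  scoped k j  n       | no j≢k   = subst (Scoped k j) (shift-other j≢k n) (shifted n)

  liftR-bound : ∀ k r → liftR {S} k r k zero ≡ zero
  liftR-bound k r = if-cong (≡ᵇ-same k)

  liftR-other : ∀ {j k} r → j ≢ k → ∀ m → liftR {S} k r j m ≡ r j m
  liftR-other r j≢k zero    = if-cong (≡ᵇ-other j≢k)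
  liftR-other r j≢k (suc m) = if-cong (≡ᵇ-other j≢k)

  liftR-shifted : ∀ k r j m → liftR {S} k r j (shift k j m) ≡ shift k j (r j m)
  liftR-shifted k r j m with j ≟ k
  ... | yes refl = begin
          liftR {S} k r k (shift k k m)  ≡⟨ ≡-cong (liftR {S} k r k) (shift-same k m) ⟩
          liftR {S} k r k (suc m)        ≡⟨ if-cong (≡ᵇ-same k) ⟩
          suc (r k m)                ≡⟨ ≡-sym (shift-same k (r k m)) ⟩
          shift k k (r k m)          ∎
  ... | no j≢k = begin
          liftR {S} k r j (shift k j m)  ≡⟨ ≡-cong (liftR {S} k r j) (shift-other j≢k m) ⟩
          liftR {S} k r j m              ≡⟨ liftR-other r j≢k m ⟩
          r j m                      ≡⟨ ≡-sym (shift-other j≢k (r j m)) ⟩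
          shift k j (r j m)          ∎

  lift2²-bound : ∀ k (τ : Sub2 {S}) → lift2² k τ k zero ≡ idAtom k zero
  lift2²-bound k τ = if-cong (≡ᵇ-same k)

  lift2²-other : ∀ {j k} (τ : Sub2 {S}) → j ≢ k → ∀ m → lift2² k τ j m ≡ ren2 (shift k) (τ j m)
  lift2²-other τ j≢k zero    = if-cong (≡ᵇ-other j≢k)
  lift2²-other τ j≢k (suc m) = if-cong (≡ᵇ-other j≢k)

  lift2²-shifted : ∀ k (τ : Sub2 {S}) j m → lift2² k τ j (shift k j m) ≡ ren2 (shift k) (τ j m)
  lift2²-shifted k τ j m with j ≟ k
  ... | yes refl = begin
          lift2² k τ k (shift k k m)  ≡⟨ ≡-cong (lift2² k τ k) (shift-same k m) ⟩
          lift2² k τ k (suc m)        ≡⟨ if-cong (≡ᵇ-same k) ⟩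
          ren2 (shift k) (τ k m)      ∎
  ... | no j≢k = ≡-trans (≡-cong (lift2² k τ j) (shift-other j≢k m)) (lift2²-other τ j≢k m)

  occ-atom : ∀ {j m k n} {ts : Vec (Term S) k} → Occ2 j m (atom k n ts) → (j ≡ k) × (m ≡ n)
  occ-atom here = refl , refl

  subTy-reflects-occ : ∀ {j m} (σ : ℕ → Term S) A → Occ2 j m (subTy σ A) → Occ2 j m A
  subTy-reflects-occ σ (atom k n ts) here     = here
  subTy-reflects-occ σ (A ⇒ B)      (⇒ˡ o)    = ⇒ˡ (subTy-reflects-occ σ A o)
  subTy-reflects-occ σ (A ⇒ B)      (⇒ʳ o)    = ⇒ʳ (subTy-reflects-occ σ B o)
  subTy-reflects-occ σ (∀¹ A)       (all¹ o)  = all¹ (subTy-reflects-occ (lift σ) A o)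
  subTy-reflects-occ σ (∀² k A)     (all² o)  = all² (subTy-reflects-occ σ A o)

  subTy-preserves-occ : ∀ {j m} (σ : ℕ → Term S) A → Occ2 j m A → Occ2 j m (subTy σ A)
  subTy-preserves-occ σ (atom k n ts) here    = here
  subTy-preserves-occ σ (A ⇒ B)      (⇒ˡ o)   = ⇒ˡ (subTy-preserves-occ σ A o)
  subTy-preserves-occ σ (A ⇒ B)      (⇒ʳ o)   = ⇒ʳ (subTy-preserves-occ σ B o)
  subTy-preserves-occ σ (∀¹ A)       (all¹ o) = all¹ (subTy-preserves-occ (lift σ) A o)
  subTy-preserves-occ σ (∀² k A)     (all² o) = all² (subTy-preserves-occ σ A o)

  ren2-reflects-occ : ∀ {j m} r (A : Ty S) → Occ2 j m (ren2 r A) → Σ[ n ∈ ℕ ] Occ2 j n A × (r j n ≡ m)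
  ren2-reflects-occ r (atom k n ts) here = n , here , refl
  ren2-reflects-occ r (A ⇒ B) (⇒ˡ o) with ren2-reflects-occ r A o
  ... | n , o′ , eq = n , ⇒ˡ o′ , eq
  ren2-reflects-occ r (A ⇒ B) (⇒ʳ o) with ren2-reflects-occ r B o
  ... | n , o′ , eq = n , ⇒ʳ o′ , eq
  ren2-reflects-occ r (∀¹ A) (all¹ o) with ren2-reflects-occ r A o
  ... | n , o′ , eq = n , all¹ o′ , eq
  ren2-reflects-occ {j} {m} r (∀² k A) (all² o) with ren2-reflects-occ (liftR {S} k r) A o
  ... | n , o′ , eq with scoped k j n
  ...   | bound    = ⊥-elim (shift-≢-bound k m (≡-trans (≡-sym eq) (liftR-bound k r)))
  ...   | shifted p = p , all² o′ ,
            shift-injective k j (≡-trans (≡-sym (liftR-shifted k r j p)) eq)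

  shift-avoids-bound : ∀ k (A : Ty S) → ¬ Occ2 k zero (ren2 (shift k) A)
  shift-avoids-bound k A o with ren2-reflects-occ (shift k) A o
  ... | p , _ , eq = shift-≢-bound k p eq

  shift-reflects-occ : ∀ k {j m} (A : Ty S) → Occ2 j (shift k j m) (ren2 (shift k) A) → Occ2 j m A
  shift-reflects-occ k {j} A o with ren2-reflects-occ (shift k) A o
  ... | p , o′ , eq = subst (λ n → Occ2 j n A) (shift-injective k j eq) o′

  sub2-reflects-occ : ∀ {j m} (τ : Sub2 {S}) A → Occ2 j m (sub2 τ A) →
                      Σ[ k ∈ ℕ ] Σ[ n ∈ ℕ ] Occ2 k n A × Occ2 j m (τ k n)
  sub2-reflects-occ τ (atom k n ts) o = k , n , here , subTy-reflects-occ (params ts) (τ k n) o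
  sub2-reflects-occ τ (A ⇒ B) (⇒ˡ o) with sub2-reflects-occ τ A o
  ... | k , n , a , b = k , n , ⇒ˡ a , b
  sub2-reflects-occ τ (A ⇒ B) (⇒ʳ o) with sub2-reflects-occ τ B o
  ... | k , n , a , b = k , n , ⇒ʳ a , b
  sub2-reflects-occ τ (∀¹ A) (all¹ o) with sub2-reflects-occ (lift2¹ τ) A o
  ... | k , n , a , b = k , n , all¹ a , subTy-reflects-occ _ (τ k n) b
  sub2-reflects-occ {j} {m} τ (∀² k′ A) (all² o) with sub2-reflects-occ (lift2² k′ τ) A o
  ... | k , n , a , b with scoped k′ k n
  ...   | bound with occ-atom (subst (Occ2 j (shift k′ j m)) (lift2²-bound k′ τ) b)
  ...     | refl , eq = ⊥-elim (shift-≢-bound k′ m eq)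
  sub2-reflects-occ {j} {m} τ (∀² k′ A) (all² o) | k , _ , a , b | shifted p =
    k , p , all² a ,
    shift-reflects-occ k′ (τ k p) (subst (Occ2 j (shift k′ j m)) (lift2²-shifted k′ τ k p) b)

  lift2²-reflects-bound : ∀ k (τ : Sub2 {S}) A → Occ2 k zero (sub2 (lift2² k τ) A) → Occ2 k zero A
  lift2²-reflects-bound k τ A o with sub2-reflects-occ (lift2² k τ) A o
  ... | j , n , a , b with scoped k j n
  ...   | bound     = a
  ...   | shifted p = ⊥-elim (shift-avoids-bound k (τ j p) (subst (Occ2 k zero) (lift2²-shifted k τ j p) b))

  subTy-Ω⁺ : ∀ (σ : ℕ → Term S) A → Ω⁺ A → Ω⁺ (subTy σ A)
  subTy-Ω⁻ : ∀ (σ : ℕ → Term S) A → Ω⁻ A → Ω⁻ (subTy σ A)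
  subTy-Ω⁺ σ bot           _          = bot⁺
  subTy-Ω⁺ σ (atom k n ts) _          = atom⁺ _ _ _
  subTy-Ω⁺ σ (A ⇒ B)      (⇒⁺ a b)   = ⇒⁺ (subTy-Ω⁻ σ A a) (subTy-Ω⁺ σ B b)
  subTy-Ω⁺ σ (∀¹ A)       (∀¹⁺ a)    = ∀¹⁺ (subTy-Ω⁺ (lift σ) A a)
  subTy-Ω⁺ σ (∀² k A)     (∀²⁺ a)    = ∀²⁺ (subTy-Ω⁺ σ A a)
  subTy-Ω⁻ σ bot           _          = bot⁻
  subTy-Ω⁻ σ (atom k n ts) _          = atom⁻ _ _ _
  subTy-Ω⁻ σ (A ⇒ B)      (⇒⁻ a b)   = ⇒⁻ (subTy-Ω⁺ σ A a) (subTy-Ω⁻ σ B b)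
  subTy-Ω⁻ σ (∀¹ A)       (∀¹⁻ a)    = ∀¹⁻ (subTy-Ω⁻ (lift σ) A a)
  subTy-Ω⁻ σ (∀² k A)     (∀²⁻ a X∉A) = ∀²⁻ (subTy-Ω⁻ σ A a) (λ o → X∉A (subTy-reflects-occ σ A o))

  subTy-reflects-Ω⁺ : ∀ (σ : ℕ → Term S) A → Ω⁺ (subTy σ A) → Ω⁺ A
  subTy-reflects-Ω⁻ : ∀ (σ : ℕ → Term S) A → Ω⁻ (subTy σ A) → Ω⁻ A
  subTy-reflects-Ω⁺ σ bot           _        = bot⁺
  subTy-reflects-Ω⁺ σ (atom k n ts) _        = atom⁺ _ _ _
  subTy-reflects-Ω⁺ σ (A ⇒ B)      (⇒⁺ a b) = ⇒⁺ (subTy-reflects-Ω⁻ σ A a) (subTy-reflects-Ω⁺ σ B b)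
  subTy-reflects-Ω⁺ σ (∀¹ A)       (∀¹⁺ a)  = ∀¹⁺ (subTy-reflects-Ω⁺ (lift σ) A a)
  subTy-reflects-Ω⁺ σ (∀² k A)     (∀²⁺ a)  = ∀²⁺ (subTy-reflects-Ω⁺ σ A a)
  subTy-reflects-Ω⁻ σ bot           _        = bot⁻
  subTy-reflects-Ω⁻ σ (atom k n ts) _        = atom⁻ _ _ _
  subTy-reflects-Ω⁻ σ (A ⇒ B)      (⇒⁻ a b) = ⇒⁻ (subTy-reflects-Ω⁺ σ A a) (subTy-reflects-Ω⁻ σ B b)
  subTy-reflects-Ω⁻ σ (∀¹ A)       (∀¹⁻ a)  = ∀¹⁻ (subTy-reflects-Ω⁻ (lift σ) A a)
  subTy-reflects-Ω⁻ σ (∀² k A)     (∀²⁻ a X∉σA) =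
    ∀²⁻ (subTy-reflects-Ω⁻ σ A a) (λ o → X∉σA (subTy-preserves-occ σ A o))

  -- Part (1): each step C[u/x] ≈ C[v/x] relates two first-order instances
  -- of C, so it preserves Ω⁺ and Ω⁻; the rest is reflexivity/transitivity.
  ≈-preserves-Ω : ∀ {E} (A B : Ty S) → E ⊢ A ≈ B → (Ω⁺ A → Ω⁺ B) × (Ω⁻ A → Ω⁻ B)
  ≈-preserves-Ω A .A refl = (λ a → a) , (λ a → a)
  ≈-preserves-Ω A C (trans {B = B} A≈B B≈C) with ≈-preserves-Ω A B A≈B | ≈-preserves-Ω B C B≈C
  ... | f⁺ , f⁻ | g⁺ , g⁻ = (λ a → g⁺ (f⁺ a)) , (λ a → g⁻ (f⁻ a))
  ≈-preserves-Ω _ _ (step C _ _) =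
    (λ a → subTy-Ω⁺ _ C (subTy-reflects-Ω⁺ _ C a)) , (λ a → subTy-Ω⁻ _ C (subTy-reflects-Ω⁻ _ C a))

  data Atomic : Ty S → Set where
    is-atom : ∀ {k n ts} → Atomic (atom k n ts)

  AtomicOn : Sub2 {S} → Ty S → Set
  AtomicOn τ A = ∀ j n → Occ2 j n A → Atomic (τ j n)

  atomic-Ω⁺ : ∀ {A} → Atomic A → Ω⁺ A
  atomic-Ω⁺ is-atom = atom⁺ _ _ _

  atomic-Ω⁻ : ∀ {A} → Atomic A → Ω⁻ A
  atomic-Ω⁻ is-atom = atom⁻ _ _ _

  subTy-atomic : ∀ (σ : ℕ → Term S) {A} → Atomic A → Atomic (subTy σ A)
  subTy-atomic σ is-atom = is-atom

  ren2-atomic : ∀ r {A : Ty S} → Atomic A → Atomic (ren2 r A)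
  ren2-atomic r is-atom = is-atom

  lift2¹-atomic : ∀ τ A → AtomicOn τ (∀¹ A) → AtomicOn (lift2¹ τ) A
  lift2¹-atomic τ A h j n o = subTy-atomic _ (h j n (all¹ o))

  lift2²-atomic : ∀ τ k A → AtomicOn τ (∀² k A) → AtomicOn (lift2² k τ) A
  lift2²-atomic τ k A h j n o with scoped k j n
  ... | bound     = subst Atomic (≡-sym (lift2²-bound k τ)) is-atom
  ... | shifted p = subst Atomic (≡-sym (lift2²-shifted k τ j p)) (ren2-atomic _ (h j p (all² o)))

  atomic-sub2-Ω⁺ : ∀ {τ} A → AtomicOn τ A → Ω⁺ A → Ω⁺ (sub2 τ A)
  atomic-sub2-Ω⁻ : ∀ {τ} A → AtomicOn τ A → Ω⁻ A → Ω⁻ (sub2 τ A)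
  atomic-sub2-Ω⁺ bot _ _ = bot⁺
  atomic-sub2-Ω⁺ (atom k n ts) h _ = atomic-Ω⁺ (subTy-atomic (params ts) (h k n here))
  atomic-sub2-Ω⁺ (A ⇒ B) h (⇒⁺ a b) =
    ⇒⁺ (atomic-sub2-Ω⁻ A (λ j n o → h j n (⇒ˡ o)) a) (atomic-sub2-Ω⁺ B (λ j n o → h j n (⇒ʳ o)) b)
  atomic-sub2-Ω⁺ {τ} (∀¹ A) h (∀¹⁺ a) = ∀¹⁺ (atomic-sub2-Ω⁺ A (lift2¹-atomic τ A h) a)
  atomic-sub2-Ω⁺ {τ} (∀² k A) h (∀²⁺ a) = ∀²⁺ (atomic-sub2-Ω⁺ A (lift2²-atomic τ k A h) a)
  atomic-sub2-Ω⁻ bot _ _ = bot⁻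
  atomic-sub2-Ω⁻ (atom k n ts) h _ = atomic-Ω⁻ (subTy-atomic (params ts) (h k n here))
  atomic-sub2-Ω⁻ (A ⇒ B) h (⇒⁻ a b) =
    ⇒⁻ (atomic-sub2-Ω⁺ A (λ j n o → h j n (⇒ˡ o)) a) (atomic-sub2-Ω⁻ B (λ j n o → h j n (⇒ʳ o)) b)
  atomic-sub2-Ω⁻ {τ} (∀¹ A) h (∀¹⁻ a) = ∀¹⁻ (atomic-sub2-Ω⁻ A (lift2¹-atomic τ A h) a)
  atomic-sub2-Ω⁻ {τ} (∀² k A) h (∀²⁻ a X∉A) =
    ∀²⁻ (atomic-sub2-Ω⁻ A (lift2²-atomic τ k A h) a) (λ o → X∉A (lift2²-reflects-bound k τ A o))

  -- When X (arity k, index 0) is not free in A, A[F/X] only replaces the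
  -- other free variables by atoms X'(x₀,…), so it is an atomic instance.
  inst²-Ω⁻ : ∀ k F A → ¬ Occ2 k zero A → Ω⁻ A → Ω⁻ (inst² k F A)
  inst²-Ω⁻ k F A X∉A = atomic-sub2-Ω⁻ A λ
    { j zero    j∈A → subst (λ b → Atomic (if b then F else idAtom j zero))
                            (≡-sym (≡ᵇ-other {j} {k} (λ { refl → X∉A j∈A }))) is-atom
    ; j (suc m) _   → if-atomic (j ≡ᵇ k) is-atom is-atom }
    where
    if-atomic : ∀ {G H} b → Atomic G → Atomic H → Atomic (if b then G else H)
    if-atomic true  g _ = g
    if-atomic false _ h = h

  -- Ω⁻ is closed under ◁: a ∀¹-instance is a first-order substitution, and
  -- ∀X A ∈ Ω⁻ requires X not free in A, so inst²-Ω⁻ applies.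
  ◁-preserves-Ω⁻ : ∀ {A C : Ty S} → Ω⁻ A → A ◁ C → Ω⁻ C
  ◁-preserves-Ω⁻ a           refl            = a
  ◁-preserves-Ω⁻ a           (trans A◁B B◁C) = ◁-preserves-Ω⁻ (◁-preserves-Ω⁻ a A◁B) B◁C
  ◁-preserves-Ω⁻ (∀¹⁻ a)     (inst¹◁ A u)    = subTy-Ω⁻ _ A a
  ◁-preserves-Ω⁻ (∀²⁻ a X∉A) (inst²◁ k A F)  = inst²-Ω⁻ k F A X∉A a

lemma4p1 : (S : Signature) (E : Term S → Term S → Set) →
    ((A B : Ty S) → E ⊢ A ≈ B → (Ω⁺ A → Ω⁺ B) × (Ω⁻ A → Ω⁻ B)) ×
    ((A B D : Ty S) → Ω⁻ A → A ◁ (B ⇒ D) → Ω⁺ B × Ω⁻ D)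
lemma4p1 S E = ≈-preserves-Ω , arrow-components
  where
  -- By closure under ◁, B ⇒ D ∈ Ω⁻, whose only rule gives both components.
  arrow-components : (A B D : Ty S) → Ω⁻ A → A ◁ (B ⇒ D) → Ω⁺ B × Ω⁻ D
  arrow-components A B D a A◁B⇒D with ◁-preserves-Ω⁻ a A◁B⇒D
  ... | ⇒⁻ b d = b , d
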